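{- For every $k\ge1$, the game of Nim with $k$ piles is miserable and forced.
   Context: Nim with $k$ piles: positions are $k$-tuples $(x_1,\dots,x_k)$ of non-negative integers; a move chooses one index $i$ with $x_i>0$ and replaces $x_i$ by any smaller non-negative integer. Terminal positions are those with no move. $\operatorname{mex}(S)$ is the least non-negative integer not in $S$. The normal Sprague–Grundy function is $\mathcal{G}(x)=\operatorname{mex}\{\mathcal{G}(y): x\to y\}$ (so $0$ on terminal positions); the misère function $\mathcal{G}^-$ satisfies $\mathcal{G}^-(x)=1$ for terminal $x$ and $\mathcal{G}^-(x)=\operatorname{mex}\{\mathcal{G}^-(y): x\to y\}$ otherwise. $V_{i,j}$ is the set of positions with $\mathcal{G}=i$, $\mathcal{G}^-=j$ (an $(i,j)$-position). A position is movable to a set $W$ if it has a move to some position of $W$. A game is miserable if every position $x$ satisfies at least one of: (a) $x\in V_{0,1}\cup V_{1,0}$; (b) $x$ is not movable to $V_{0,1}\cup V_{1,0}$; (c) $x$ is movable to $V_{0,1}$ and to $V_{1,0}$. A game is forced if every move from a $(0,1)$-position leads to a $(1,0)$-position and every move from a $(1,0)$-position leads to a $(0,1)$-position. -}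

module Defs where

open import Data.Nat using (ℕ; zero; suc; _<_; _≡ᵇ_)
open import Data.Bool using (Bool; true; false; if_then_else_)
open import Data.List as List using (List; []; _∷_; length; concatMap; upTo; allFin)
open import Data.Bool.ListAction using (any)
open import Data.Vec using (Vec; lookup; _[_]≔_; sum; toList)
open import Data.Fin using (Fin)
open import Data.Product using (Σ; ∃; _×_; _,_)
open import Data.Sum using (_⊎_)
open import Relation.Binary.PropositionalEquality using (_≡_)
open import Relation.Nullary using (¬_)

Pos : ℕ → Set
Pos k = Vec ℕ k

Move : ∀ {k} → Pos k → Pos k → Set
Move {k} x y = Σ (Fin k) λ i → Σ ℕ λ j → (j < lookup x i) × (y ≡ x [ i ]≔ j)

options : ∀ {k} → Pos k → List (Pos k)
options {k} x = concatMap (λ i → List.map (λ j → x [ i ]≔ j) (upTo (lookup x i))) (allFin k)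

-- mex of a finite list of naturals: least n not in the list.
-- (Searching 0, 1, ..., length L suffices, since these length L + 1
--  numbers cannot all occur in L.)
mexSearch : ℕ → ℕ → List ℕ → ℕ
mexSearch zero     n L = n
mexSearch (suc f)  n L = if any (λ m → m ≡ᵇ n) L then mexSearch f (suc n) L else n

mex : List ℕ → ℕ
mex L = mexSearch (length L) 0 L

-- Normal Sprague–Grundy function, by recursion on a fuel bound on the
-- total number of tokens (every move strictly decreases the total).
Gfuel : ∀ {k} → ℕ → Pos k → ℕ
Gfuel zero    x = 0
Gfuel (suc n) x = mex (List.map (Gfuel n) (options x))

G : ∀ {k} → Pos k → ℕ
G x = Gfuel (sum x) x

G⁻fuel : ∀ {k} → ℕ → Pos k → ℕ
G⁻fuel zero    x = 1
G⁻fuel (suc n) x with options x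
... | []     = 1
... | o ∷ os = mex (List.map (G⁻fuel n) (o ∷ os))

G⁻ : ∀ {k} → Pos k → ℕ
G⁻ x = G⁻fuel (sum x) x

V : ∀ {k} → ℕ → ℕ → Pos k → Set
V i j x = (G x ≡ i) × (G⁻ x ≡ j)

MovableTo : ∀ {k} → (Pos k → Set) → Pos k → Set
MovableTo W x = ∃ λ y → Move x y × W y

V01∪V10 : ∀ {k} → Pos k → Set
V01∪V10 x = V 0 1 x ⊎ V 1 0 x

Miserable : ℕ → Set
Miserable k = (x : Pos k) →
  V01∪V10 x ⊎ (¬ MovableTo V01∪V10 x ⊎ (MovableTo (V 0 1) x × MovableTo (V 1 0) x))

Forced : ℕ → Set
Forced k = (x y : Pos k) → Move x y →
  (V 0 1 x → V 1 0 y) × (V 1 0 x → V 0 1 y)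

-- Call a position small when every pile holds at most one token.  A move from
-- a small position removes exactly one token and stays small, so there G is the
-- parity of the token count and G⁻ its complement; thus the small positions are
-- exactly V₀₁ ∪ V₁₀ and every move between them swaps (0,1) and (1,0).  At a
-- position with a pile of size ≥ 2 the options carry the same sets of G- and
-- G⁻-values: non-small options agree by induction, and as soon as one option is
-- small the big pile is unique, so cutting it down to 0 or to 1 yields small
-- options with both values 0 and 1 under both functions.  Hence G = G⁻ away
-- from the small positions, and such a position is movable to V₀₁ ∪ V₁₀ exactly
-- when it has a single big pile, in which case it is movable to both parts.
module Submission where

open import Defs
open import Data.Bool using (true; false; T)
open import Data.Bool.ListAction using (any)
open import Data.Bool.Properties using (T-≡; ⇔→≡)
open import Data.Empty using (⊥-elim)
open import Data.Fin using (Fin; zero; suc)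
open import Data.Fin.Properties using (all?; ¬∀⟶∃¬) renaming (_≟_ to _≟ᶠ_)
open import Data.List as List using (List; []; _∷_; length)
open import Data.List.Membership.Propositional using (_∈_; _∉_)
open import Data.List.Membership.Propositional.Properties
  using (∈-map⁺; ∈-map⁻; ∈-concatMap⁺; ∈-concatMap⁻; ∈-upTo⁺; ∈-upTo⁻; ∈-allFin)
open import Data.List.Properties using (length-map; map-cong-local)
open import Data.List.Relation.Binary.Subset.Propositional using (_⊆_)
open import Data.List.Relation.Unary.All as All using ()
open import Data.List.Relation.Unary.Any as Any using (Any; here; there)
open import Data.List.Relation.Unary.Any.Properties using (any⁺; any⁻)
open import Data.Nat using (ℕ; zero; suc; _+_; _∸_; _≤_; _<_; _≥_; _≡ᵇ_; z≤n; s≤s; z<s; _≤?_)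
open import Data.Nat.Induction using (<-wellFounded)
open import Data.Nat.Properties
open import Algebra.Properties.CommutativeSemigroup +-commutativeSemigroup using (x∙yz≈y∙xz)
open import Data.Product using (_×_; _,_; ∃; proj₁; proj₂)
open import Data.Sum using (_⊎_; inj₁; inj₂)
open import Data.Vec using (Vec; []; _∷_; lookup; _[_]≔_; sum)
open import Data.Vec.Properties using (lookup∘update; lookup∘update′; []≔-idempotent)
open import Function using (_⇔_; _∘_)
open import Function.Bundles using (Equivalence; mk⇔)
open import Induction.WellFounded using (module All)
open import Relation.Binary.Construct.On as On using ()
open import Relation.Binary.PropositionalEquality
open import Relation.Nullary using (¬_; Dec; yes; no)
open import Relation.Nullary.Decidable using (_⊎-dec_)

open Equivalence using (to; from)

T-any-≡ᵇ⇔∈ : ∀ {n} (L : List ℕ) → T (any (_≡ᵇ n) L) ⇔ n ∈ L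
T-any-≡ᵇ⇔∈ {n} L = mk⇔
  (Any.map (λ {m} t → sym (≡ᵇ⇒≡ m n t)) ∘ any⁻ _ L)
  (any⁺ _ ∘ Any.map (λ {m} n≡m → ≡⇒≡ᵇ m n (sym n≡m)))

any-≡ᵇ-true : ∀ {n L} → n ∈ L → any (_≡ᵇ n) L ≡ true
any-≡ᵇ-true {L = L} n∈L = to T-≡ (from (T-any-≡ᵇ⇔∈ L) n∈L)

any-≡ᵇ-false : ∀ {n} L → n ∉ L → any (_≡ᵇ n) L ≡ false
any-≡ᵇ-false {n} L n∉L with any (_≡ᵇ n) L in eq
... | true  = ⊥-elim (n∉L (to (T-any-≡ᵇ⇔∈ L) (subst T (sym eq) _)))
... | false = refl

any-≡ᵇ-cong : ∀ {n L₁ L₂} → L₁ ⊆ L₂ → L₂ ⊆ L₁ → any (_≡ᵇ n) L₁ ≡ any (_≡ᵇ n) L₂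
any-≡ᵇ-cong {L₁ = L₁} {L₂} ⊆₁₂ ⊆₂₁ = ⇔→≡ {z = true} (mk⇔ (transport ⊆₁₂) (transport ⊆₂₁))
  where
  transport : ∀ {n L L′} → L ⊆ L′ → any (_≡ᵇ n) L ≡ true → any (_≡ᵇ n) L′ ≡ true
  transport {L = L} {L′} ⊆′ = to T-≡ ∘ from (T-any-≡ᵇ⇔∈ L′) ∘ ⊆′ ∘ to (T-any-≡ᵇ⇔∈ L) ∘ from T-≡

mexSearch-cong : ∀ f n {L₁ L₂} → L₁ ⊆ L₂ → L₂ ⊆ L₁ → mexSearch f n L₁ ≡ mexSearch f n L₂
mexSearch-cong zero    n           _   _   = refl
mexSearch-cong (suc f) n {L₁} {L₂} ⊆₁₂ ⊆₂₁ rewrite any-≡ᵇ-cong {n} ⊆₁₂ ⊆₂₁ with any (_≡ᵇ n) L₂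
... | true  = mexSearch-cong f (suc n) ⊆₁₂ ⊆₂₁
... | false = refl

-- mex L only searches 0, …, length L, hence the length hypothesis.
mex-cong : ∀ {L₁ L₂} → length L₁ ≡ length L₂ → L₁ ⊆ L₂ → L₂ ⊆ L₁ → mex L₁ ≡ mex L₂
mex-cong {L₁} {L₂} eq ⊆₁₂ ⊆₂₁ rewrite eq = mexSearch-cong (length L₂) 0 ⊆₁₂ ⊆₂₁

mex-≡0 : ∀ L → 0 ∉ L → mex L ≡ 0
mex-≡0 []          _   = refl
mex-≡0 L@(_ ∷ _) 0∉L rewrite any-≡ᵇ-false L 0∉L = refl

mex-≡1 : ∀ L → 0 ∈ L → 1 ∉ L → mex L ≡ 1
mex-≡1 L@(_ ∷ xs) 0∈L 1∉L rewrite any-≡ᵇ-true 0∈L with length xs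
... | zero  = refl
... | suc _ rewrite any-≡ᵇ-false L 1∉L = refl

mex-map-constant : ∀ {A : Set} {f : A → ℕ} {xs z w} → w ≤ 1 → z ∈ xs →
                   (∀ {y} → y ∈ xs → f y ≡ w) → mex (List.map f xs) ≡ 1 ∸ w
mex-map-constant {f = f} {xs} {w = zero} _ z∈xs f≡w =
  mex-≡1 (List.map f xs) (subst (_∈ List.map f xs) (f≡w z∈xs) (∈-map⁺ f z∈xs)) 1∉
  where
  1∉ : 1 ∉ List.map f xs
  1∉ 1∈ with ∈-map⁻ f 1∈
  ... | _ , y∈xs , 1≡fy = 0≢1+n (sym (trans 1≡fy (f≡w y∈xs)))
mex-map-constant {f = f} {xs} {w = suc zero} _ _ f≡w = mex-≡0 (List.map f xs) 0∉
  where
  0∉ : 0 ∉ List.map f xs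
  0∉ 0∈ with ∈-map⁻ f 0∈
  ... | _ , y∈xs , 0≡fy = 0≢1+n (trans 0≡fy (f≡w y∈xs))
mex-map-constant {w = suc (suc _)} (s≤s ()) _ _

parity : ℕ → ℕ
parity zero    = 0
parity (suc n) = 1 ∸ parity n

parity≤1 : ∀ n → parity n ≤ 1
parity≤1 zero    = z≤n
parity≤1 (suc n) = m∸n≤m 1 (parity n)

parity-01 : ∀ n → parity n ≡ 0 ⊎ parity n ≡ 1
parity-01 zero    = inj₁ refl
parity-01 (suc n) with parity n | parity-01 n
... | _ | inj₁ refl = inj₂ refl
... | _ | inj₂ refl = inj₁ refl

parity-suc-suc : ∀ n → parity (suc (suc n)) ≡ parity n
parity-suc-suc n = m∸[m∸n]≡n (parity≤1 n)

sum-[]≔ : ∀ {k} (x : Vec ℕ k) i j → lookup x i + sum (x [ i ]≔ j) ≡ j + sum x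
sum-[]≔ (a ∷ x) zero    j = x∙yz≈y∙xz a j (sum x)
sum-[]≔ (a ∷ x) (suc i) j = begin
  lookup x i + (a + sum (x [ i ]≔ j)) ≡⟨ x∙yz≈y∙xz (lookup x i) a _ ⟩
  a + (lookup x i + sum (x [ i ]≔ j)) ≡⟨ cong (a +_) (sum-[]≔ x i j) ⟩
  a + (j + sum x)                     ≡⟨ x∙yz≈y∙xz a j (sum x) ⟩
  j + (a + sum x)                     ∎
  where open ≡-Reasoning

Move⇒sum< : ∀ {k} {x y : Pos k} → Move x y → sum y < sum x
Move⇒sum< {x = x} (i , j , j<xᵢ , refl) = +-cancelˡ-< (lookup x i) _ _
  (subst (_< lookup x i + sum x) (sym (sum-[]≔ x i j)) (+-monoˡ-< (sum x) j<xᵢ))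

∈-options⁻ : ∀ {k} {x y : Pos k} → y ∈ options x → Move x y
∈-options⁻ {k} {x} y∈ = go (∈-concatMap⁻ _ {xs = List.allFin k} y∈)
  where
  go : ∀ {is} → Any (λ i → _ ∈ List.map (x [ i ]≔_) (List.upTo (lookup x i))) is → Move x _
  go (here p) with ∈-map⁻ _ p
  ... | j , j∈ , refl = _ , j , ∈-upTo⁻ j∈ , refl
  go (there p) = go p

∈-options⁺ : ∀ {k} {x y : Pos k} → Move x y → y ∈ options x
∈-options⁺ {k} {x} (i , j , j<xᵢ , refl) = ∈-concatMap⁺ _ (go (∈-allFin i))
  where
  go : ∀ {is} → i ∈ is → Any (λ i′ → x [ i ]≔ j ∈ List.map (x [ i′ ]≔_) (List.upTo (lookup x i′))) is
  go (here refl) = here (∈-map⁺ _ (∈-upTo⁺ j<xᵢ))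
  go (there p)   = there (go p)

options-terminal : ∀ {k} (x : Pos k) → sum x ≡ 0 → options x ≡ []
options-terminal x sum≡0 with options x in eq
... | []    = refl
... | y ∷ _ = ⊥-elim (n≮0 (subst (sum y <_) sum≡0
                (Move⇒sum< (∈-options⁻ (subst (y ∈_) (sym eq) (here refl))))))

sum-zero-or-pile : ∀ {k} (x : Vec ℕ k) → sum x ≡ 0 ⊎ ∃ λ i → 0 < lookup x i
sum-zero-or-pile []          = inj₁ refl
sum-zero-or-pile (suc a ∷ x) = inj₂ (zero , z<s)
sum-zero-or-pile (zero ∷ x) with sum-zero-or-pile x
... | inj₁ sum≡0     = inj₁ sum≡0
... | inj₂ (i , pos) = inj₂ (suc i , pos)

sum-rec : ∀ {k} (P : Pos k → Set) → (∀ x → (∀ {y} → sum y < sum x → P y) → P x) → ∀ x → P x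
sum-rec = All.wfRec (On.wellFounded sum <-wellFounded) _

module FuelIrrelevance {k} (step : List ℕ → ℕ) (F : ℕ → Pos k → ℕ)
  (F-zero : ∀ x → F 0 x ≡ step [])
  (F-suc : ∀ n x → F (suc n) x ≡ step (List.map (F n) (options x))) where

  fuel-terminal : ∀ n x → sum x ≡ 0 → F 0 x ≡ F n x
  fuel-terminal zero    x _     = refl
  fuel-terminal (suc n) x sum≡0 = begin
    F 0 x                                 ≡⟨ F-zero x ⟩
    step []                               ≡⟨ cong (step ∘ List.map (F n)) (sym (options-terminal x sum≡0)) ⟩
    step (List.map (F n) (options x))     ≡⟨ F-suc n x ⟨
    F (suc n) x                           ∎
    where open ≡-Reasoning

  fuel-irrelevant : ∀ m n x → sum x ≤ m → sum x ≤ n → F m x ≡ F n x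
  fuel-irrelevant zero    n       x s≤0 _   = fuel-terminal n x (n≤0⇒n≡0 s≤0)
  fuel-irrelevant (suc m) zero    x _   s≤0 = sym (fuel-terminal (suc m) x (n≤0⇒n≡0 s≤0))
  fuel-irrelevant (suc m) (suc n) x s≤m s≤n = begin
    F (suc m) x                       ≡⟨ F-suc m x ⟩
    step (List.map (F m) (options x)) ≡⟨ cong step (map-cong-local (All.tabulate options-agree)) ⟩
    step (List.map (F n) (options x)) ≡⟨ F-suc n x ⟨
    F (suc n) x                       ∎
    where
    open ≡-Reasoning
    options-agree : ∀ {y} → y ∈ options x → F m y ≡ F n y
    options-agree y∈ = fuel-irrelevant m n _ (≤-pred (<-≤-trans y< s≤m)) (≤-pred (<-≤-trans y< s≤n))
      where y< = Move⇒sum< (∈-options⁻ y∈)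

  unfold : ∀ x → F (sum x) x ≡ step (List.map (λ y → F (sum y) y) (options x))
  unfold x = begin
    F (sum x) x                               ≡⟨ fuel-irrelevant _ _ x ≤-refl (n≤1+n _) ⟩
    F (suc (sum x)) x                         ≡⟨ F-suc _ x ⟩
    step (List.map (F (sum x)) (options x))   ≡⟨ cong step (map-cong-local (All.tabulate options-agree)) ⟩
    step (List.map (λ y → F (sum y) y) (options x)) ∎
    where
    open ≡-Reasoning
    options-agree : ∀ {y} → y ∈ options x → F (sum x) y ≡ F (sum y) y
    options-agree y∈ = fuel-irrelevant _ _ _ (<⇒≤ (Move⇒sum< (∈-options⁻ y∈))) ≤-refl

misèreMex : List ℕ → ℕ
misèreMex []          = 1
misèreMex L@(_ ∷ _) = mex L

misèreMex-∈ : ∀ {v L} → v ∈ L → misèreMex L ≡ mex L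
misèreMex-∈ (here _)  = refl
misèreMex-∈ (there _) = refl

G⁻fuel-suc : ∀ {k} n (x : Pos k) → G⁻fuel (suc n) x ≡ misèreMex (List.map (G⁻fuel n) (options x))
G⁻fuel-suc n x with options x
... | []    = refl
... | _ ∷ _ = refl

G-unfold : ∀ {k} (x : Pos k) → G x ≡ mex (List.map G (options x))
G-unfold = FuelIrrelevance.unfold mex Gfuel (λ _ → refl) (λ _ _ → refl)

G⁻-unfold : ∀ {k} (x : Pos k) → G⁻ x ≡ misèreMex (List.map G⁻ (options x))
G⁻-unfold = FuelIrrelevance.unfold misèreMex G⁻fuel (λ _ → refl) G⁻fuel-suc

G-terminal : ∀ {k} {x : Pos k} → options x ≡ [] → G x ≡ 0
G-terminal {x = x} eq = trans (G-unfold x) (cong (mex ∘ List.map G) eq)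

G⁻-terminal : ∀ {k} {x : Pos k} → options x ≡ [] → G⁻ x ≡ 1
G⁻-terminal {x = x} eq = trans (G⁻-unfold x) (cong (misèreMex ∘ List.map G⁻) eq)

G⁻-nonterminal : ∀ {k} {x y : Pos k} → y ∈ options x → G⁻ x ≡ mex (List.map G⁻ (options x))
G⁻-nonterminal {x = x} y∈ = trans (G⁻-unfold x) (misèreMex-∈ (∈-map⁺ G⁻ y∈))

Small : ∀ {k} → Pos k → Set
Small x = ∀ i → lookup x i ≤ 1

SmallExcept : ∀ {k} → Fin k → Pos k → Set
SmallExcept b x = ∀ i → i ≡ b ⊎ lookup x i ≤ 1

small? : ∀ {k} (x : Pos k) → Dec (Small x)
small? x = all? (λ i → lookup x i ≤? 1)

smallExcept? : ∀ {k} b (x : Pos k) → Dec (SmallExcept b x)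
smallExcept? b x = all? (λ i → (i ≟ᶠ b) ⊎-dec (lookup x i ≤? 1))

¬small⇒big-pile : ∀ {k} {x : Pos k} → ¬ Small x → ∃ λ b → 2 ≤ lookup x b
¬small⇒big-pile {k} {x} ¬small with ¬∀⟶∃¬ k _ (λ i → lookup x i ≤? 1) ¬small
... | b , xᵦ≰1 = b , ≰⇒> xᵦ≰1

small-[]≔ : ∀ {k} {b} {x : Pos k} {j} → SmallExcept b x → j ≤ 1 → Small (x [ b ]≔ j)
small-[]≔ {b = b} {x} {j} except j≤1 i with i ≟ᶠ b | except i
... | yes refl | _        = subst (_≤ 1) (sym (lookup∘update b x j)) j≤1
... | no i≢b   | inj₁ i≡b = ⊥-elim (i≢b i≡b)
... | no i≢b   | inj₂ xᵢ≤1 = subst (_≤ 1) (sym (lookup∘update′ i≢b x j)) xᵢ≤1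

small-option⇒smallExcept : ∀ {k} {x y : Pos k} {b} → 2 ≤ lookup x b → Move x y → Small y →
                           SmallExcept b x
small-option⇒smallExcept {x = x} {b = b} big (i , j , _ , refl) small c with i ≟ᶠ b | c ≟ᶠ b
... | _        | yes c≡b = inj₁ c≡b
... | yes refl | no c≢b  = inj₂ (subst (_≤ 1) (lookup∘update′ c≢b x j) (small c))
... | no i≢b   | _       = ⊥-elim (<⇒≱ big (subst (_≤ 1) (lookup∘update′ (≢-sym i≢b) x j) (small b)))

small-move : ∀ {k} (x y : Pos k) → Small x → Move x y → Small y × sum x ≡ suc (sum y)
small-move x _ small (i , zero , 0<xᵢ , refl) =
  small-[]≔ {x = x} (λ c → inj₂ (small c)) z≤n ,
  trans (sym (sum-[]≔ x i 0)) (cong (_+ sum (x [ i ]≔ 0)) (≤-antisym (small i) 0<xᵢ))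
small-move _ _ small (i , suc j , j<xᵢ , _) = ⊥-elim (<⇒≱ j<xᵢ (≤-trans (small i) (s≤s z≤n)))

ParityValues : ∀ {k} → ℕ → Pos k → Set
ParityValues t x = G x ≡ parity t × G⁻ x ≡ parity (suc t)

small-values : ∀ {k} (x : Pos k) → Small x → ParityValues (sum x) x
small-values = sum-rec (λ x → Small x → ParityValues (sum x) x) step
  where
  step : ∀ x → (∀ {y} → sum y < sum x → Small y → ParityValues (sum y) y) → Small x → ParityValues (sum x) x
  step x ih small with sum-zero-or-pile x
  ... | inj₁ sum≡0 = subst (λ t → ParityValues t x) (sym sum≡0) (G-terminal terminal , G⁻-terminal terminal)
    where terminal = options-terminal x sum≡0
  ... | inj₂ (i , pos) = subst (λ t → ParityValues t x) (sym sum≡)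
    ( trans (G-unfold x) (mex-map-constant (parity≤1 s) z∈ (proj₁ ∘ option-values))
    , trans (G⁻-nonterminal z∈) (mex-map-constant (parity≤1 (suc s)) z∈ (proj₂ ∘ option-values)))
    where
    z∈ = ∈-options⁺ {x = x} (i , 0 , pos , refl)
    s = sum (x [ i ]≔ 0)
    sum≡ : sum x ≡ suc s
    sum≡ = proj₂ (small-move x _ small (i , 0 , pos , refl))
    option-values : ∀ {y} → y ∈ options x → ParityValues s y
    option-values {y} y∈ with small-move x y small (∈-options⁻ y∈)
    ... | small-y , sum≡y = subst (λ t → ParityValues t y) (suc-injective (trans (sym sum≡y) sum≡))
                                  (ih {y} (Move⇒sum< (∈-options⁻ y∈)) small-y)

small-values≤1 : ∀ {k} (x : Pos k) → Small x → G x ≤ 1 × G⁻ x ≤ 1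
small-values≤1 x small with small-values x small
... | G≡ , G⁻≡ = subst (_≤ 1) (sym G≡) (parity≤1 (sum x)) , subst (_≤ 1) (sym G⁻≡) (parity≤1 (suc (sum x)))

small-move-swaps : ∀ {k} (x y : Pos k) → Small x → Move x y → G y ≡ G⁻ x × G⁻ y ≡ G x
small-move-swaps x y small x→y with small-move x y small x→y
... | small-y , sum≡ = G-swap , G⁻-swap
  where
  open ≡-Reasoning
  G-swap : G y ≡ G⁻ x
  G-swap = begin
    G y                        ≡⟨ proj₁ (small-values y small-y) ⟩
    parity (sum y)             ≡⟨ parity-suc-suc (sum y) ⟨
    parity (suc (suc (sum y))) ≡⟨ cong (parity ∘ suc) sum≡ ⟨
    parity (suc (sum x))       ≡⟨ proj₂ (small-values x small) ⟨
    G⁻ x                       ∎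
  G⁻-swap : G⁻ y ≡ G x
  G⁻-swap = begin
    G⁻ y                 ≡⟨ proj₂ (small-values y small-y) ⟩
    parity (suc (sum y)) ≡⟨ cong parity sum≡ ⟨
    parity (sum x)       ≡⟨ proj₁ (small-values x small) ⟨
    G x                  ∎

V-swap : ∀ {k} (x y : Pos k) {i j} → Small x → Move x y → V i j x → V j i y
V-swap x y small x→y (G≡i , G⁻≡j) with small-move-swaps x y small x→y
... | G-swap , G⁻-swap = trans G-swap G⁻≡j , trans G⁻-swap G≡i

small⇒V01∪V10 : ∀ {k} (x : Pos k) → Small x → V01∪V10 x
small⇒V01∪V10 x small with small-values x small | parity-01 (sum x)
... | G≡ , G⁻≡ | inj₁ p≡0 = inj₁ (trans G≡ p≡0 , trans G⁻≡ (cong (1 ∸_) p≡0))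
... | G≡ , G⁻≡ | inj₂ p≡1 = inj₂ (trans G≡ p≡1 , trans G⁻≡ (cong (1 ∸_) p≡1))

movable-to-both : ∀ {k} (x : Pos k) b → 2 ≤ lookup x b → SmallExcept b x →
                  MovableTo (V 0 1) x × MovableTo (V 1 0) x
movable-to-both x b big except = both (small⇒V01∪V10 (x [ b ]≔ 1) small₁)
  where
  small₁ : Small (x [ b ]≔ 1)
  small₁ = small-[]≔ {x = x} except (s≤s z≤n)
  x→z₀ : Move x (x [ b ]≔ 0)
  x→z₀ = b , 0 , <-trans z<s big , refl
  x→z₁ : Move x (x [ b ]≔ 1)
  x→z₁ = b , 1 , big , refl
  z₁→z₀ : Move (x [ b ]≔ 1) (x [ b ]≔ 0)
  z₁→z₀ = b , 0 , subst (0 <_) (sym (lookup∘update b x 1)) z<s , sym ([]≔-idempotent x b)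
  both : V01∪V10 (x [ b ]≔ 1) → MovableTo (V 0 1) x × MovableTo (V 1 0) x
  both (inj₁ v₁) = (_ , x→z₁ , v₁) , (_ , x→z₀ , V-swap _ _ small₁ z₁→z₀ v₁)
  both (inj₂ v₁) = (_ , x→z₀ , V-swap _ _ small₁ z₁→z₀ v₁) , (_ , x→z₁ , v₁)

Move⇒∈-map-options : ∀ {k} (x y : Pos k) (F : Pos k → ℕ) {v} → Move x y → F y ≡ v →
                     v ∈ List.map F (options x)
Move⇒∈-map-options x y F x→y Fy≡v = subst (_∈ _) Fy≡v (∈-map⁺ F (∈-options⁺ x→y))

single-big-pile-values : ∀ {k} (x : Pos k) b {v} → 2 ≤ lookup x b → SmallExcept b x → v ≤ 1 →
                         v ∈ List.map G (options x) × v ∈ List.map G⁻ (options x)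
single-big-pile-values x b {v} big except v≤1 with movable-to-both x b big except
... | (z , x→z , Gz≡0 , G⁻z≡1) , (z′ , x→z′ , Gz′≡1 , G⁻z′≡0) = values v v≤1
  where
  values : ∀ v → v ≤ 1 → v ∈ List.map G (options x) × v ∈ List.map G⁻ (options x)
  values zero          _        = Move⇒∈-map-options x z G x→z Gz≡0 , Move⇒∈-map-options x z′ G⁻ x→z′ G⁻z′≡0
  values (suc zero)    _        = Move⇒∈-map-options x z′ G x→z′ Gz′≡1 , Move⇒∈-map-options x z G⁻ x→z G⁻z≡1
  values (suc (suc _)) (s≤s ())

-- A small option forces b to be the only big pile, and then every value ≤ 1 occurs anyway.
options-values-⊆ : ∀ {k} (x : Pos k) b → 2 ≤ lookup x b → (F F′ : Pos k → ℕ) →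
                   (∀ {y} → y ∈ options x → ¬ Small y → F y ≡ F′ y) →
                   (∀ {y} → Small y → F y ≤ 1) →
                   (∀ {v} → SmallExcept b x → v ≤ 1 → v ∈ List.map F′ (options x)) →
                   List.map F (options x) ⊆ List.map F′ (options x)
options-values-⊆ x b big F F′ F≡F′ F≤1 covered m∈ with ∈-map⁻ F m∈
... | y , y∈ , refl with small? y
... | no ¬small-y = Move⇒∈-map-options x y F′ (∈-options⁻ y∈) (sym (F≡F′ y∈ ¬small-y))
... | yes small-y = covered (small-option⇒smallExcept {x = x} {y} big (∈-options⁻ y∈) small-y) (F≤1 small-y)

nonsmall-G≡G⁻ : ∀ {k} (x : Pos k) → ¬ Small x → G x ≡ G⁻ x
nonsmall-G≡G⁻ = sum-rec (λ x → ¬ Small x → G x ≡ G⁻ x) step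
  where
  step : ∀ x → (∀ {y} → sum y < sum x → ¬ Small y → G y ≡ G⁻ y) → ¬ Small x → G x ≡ G⁻ x
  step x ih ¬small with ¬small⇒big-pile {x = x} ¬small
  ... | b , big = begin
    G x                           ≡⟨ G-unfold x ⟩
    mex (List.map G (options x))  ≡⟨ mex-cong same-length G⊆G⁻ G⁻⊆G ⟩
    mex (List.map G⁻ (options x)) ≡⟨ G⁻-nonterminal (∈-options⁺ {x = x} (b , 0 , <-trans z<s big , refl)) ⟨
    G⁻ x                          ∎
    where
    open ≡-Reasoning
    same-length : length (List.map G (options x)) ≡ length (List.map G⁻ (options x))
    same-length = trans (length-map G (options x)) (sym (length-map G⁻ (options x)))
    ih-options : ∀ {y} → y ∈ options x → ¬ Small y → G y ≡ G⁻ y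
    ih-options {y} y∈ = ih {y} (Move⇒sum< (∈-options⁻ y∈))
    G⊆G⁻ : List.map G (options x) ⊆ List.map G⁻ (options x)
    G⊆G⁻ = options-values-⊆ x b big G G⁻ ih-options
             (λ {y} s → proj₁ (small-values≤1 y s))
             (λ except v≤1 → proj₂ (single-big-pile-values x b big except v≤1))
    G⁻⊆G : List.map G⁻ (options x) ⊆ List.map G (options x)
    G⁻⊆G = options-values-⊆ x b big G⁻ G (λ y∈ ¬s → sym (ih-options y∈ ¬s))
             (λ {y} s → proj₂ (small-values≤1 y s))
             (λ except v≤1 → proj₁ (single-big-pile-values x b big except v≤1))

V01∪V10⇒small : ∀ {k} (x : Pos k) → V01∪V10 x → Small x
V01∪V10⇒small x v with small? x
... | yes small = small
... | no ¬small with v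
...   | inj₁ (G≡0 , G⁻≡1) = ⊥-elim (0≢1+n (trans (sym G≡0) (trans (nonsmall-G≡G⁻ x ¬small) G⁻≡1)))
...   | inj₂ (G≡1 , G⁻≡0) = ⊥-elim (0≢1+n (trans (sym G⁻≡0) (trans (sym (nonsmall-G≡G⁻ x ¬small)) G≡1)))

forced : ∀ k → Forced k
forced k x y x→y = (λ v → V-swap x y (V01∪V10⇒small x (inj₁ v)) x→y v)
                 , (λ v → V-swap x y (V01∪V10⇒small x (inj₂ v)) x→y v)

miserable : ∀ k → Miserable k
miserable k x with small? x
... | yes small = inj₁ (small⇒V01∪V10 x small)
... | no ¬small with ¬small⇒big-pile {x = x} ¬small
... | b , big with smallExcept? b x
... | yes except = inj₂ (inj₂ (movable-to-both x b big except))
... | no ¬except = inj₂ (inj₁ λ (y , x→y , v) →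
                    ¬except (small-option⇒smallExcept {x = x} {y} big x→y (V01∪V10⇒small y v)))

proposition6p2 : (k : ℕ) → k ≥ 1 → Miserable k × Forced k
proposition6p2 k _ = miserable k , forced k
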